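{- Let $\mathcal{Y}\subseteq\mathbb{Z}^k_{\ge0}$ be the objective vector set of an instance of a multicriteria discrete minimization problem, let $\bar y$ be a feasible reference point, let $\alpha>1$ and let $\mathcal{Y}_\alpha$ be an $\alpha$-approximate Pareto set. Then for every monotone norm $\|\cdot\|$ on $\mathbb{R}^k$, $$\min_{y\in\mathcal{Y}_\alpha}r(y)\le\alpha\cdot\min_{y\in\mathcal{Y}}r(y),\qquad\text{where } r(y)=\|\bar y\|+\|y-\bar y\|.$$
   Context: Vectors are compared componentwise. $y\in\mathcal{Y}$ is Pareto optimal if there is no $y'\in\mathcal{Y}\setminus\{y\}$ with $y'\le y$; $\mathcal{Y}_P$ denotes the set of Pareto optimal vectors. An $\alpha$-approximate Pareto set is a set $\mathcal{Y}_\alpha\subseteq\mathcal{Y}$ such that for every $y\in\mathcal{Y}_P$ there is $y'\in\mathcal{Y}_\alpha$ with $y'\le\alpha y$. The ideal point is $y^{\mathrm{id}}_i=\min_{y\in\mathcal{Y}}y_i$; a feasible reference point is $\bar y\in\mathbb{Z}^k_{\ge0}$ with $\bar y\le y^{\mathrm{id}}$. A norm is monotone if $0\le y'\le y''$ implies $\|y'\|\le\|y''\|$. -}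

module Defs where

open import Level using (_⊔_) renaming (suc to lsuc)
open import Algebra.Bundles using (CommutativeRing)
open import Relation.Binary.Core using (Rel)
open import Relation.Binary.Structures using (IsTotalOrder)
open import Relation.Binary.PropositionalEquality using (_≡_)
open import Relation.Nullary using (¬_)
open import Data.Product using (∃; _×_; _,_)
open import Data.Nat as ℕ using (ℕ; zero; suc; _⊓_)
open import Data.Fin using (Fin)
open import Data.Vec using (Vec; lookup; tabulate)
open import Data.List using (List)
open import Data.List.NonEmpty using (List⁺; toList; foldr₁) renaming (map to map⁺)
open import Data.List.Membership.Propositional using (_∈_)
open import Data.List.Relation.Unary.All using (All)

-- An ordered field (stand-in for ℝ, which agda-stdlib lacks).
record OrderedField c ℓ₁ ℓ₂ : Set (lsuc (c ⊔ ℓ₁ ⊔ ℓ₂)) where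
  field
    commutativeRing : CommutativeRing c ℓ₁
  open CommutativeRing commutativeRing public
  field
    _≤_          : Rel Carrier ℓ₂
    isTotalOrder : IsTotalOrder _≈_ _≤_
    +-mono-≤     : ∀ {a b} d → a ≤ b → (a + d) ≤ (b + d)
    *-nonneg     : ∀ {a b} → 0# ≤ a → 0# ≤ b → 0# ≤ (a * b)
    0≉1          : ¬ (0# ≈ 1#)
    inverse      : ∀ x → ¬ (x ≈ 0#) → ∃ λ y → (x * y) ≈ 1#

  _<_ : Rel Carrier (ℓ₁ ⊔ ℓ₂)
  a < b = (a ≤ b) × ¬ (a ≈ b)

  fromℕ : ℕ → Carrier
  fromℕ zero    = 0#
  fromℕ (suc n) = 1# + fromℕ n

module _ {c ℓ₁ ℓ₂} (F : OrderedField c ℓ₁ ℓ₂) where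
  open OrderedField F

  -- A norm on F^k (vectors as functions Fin k → F).
  -- Absolute homogeneity ‖a x‖ = |a| ‖x‖ is written out as
  -- homogeneity for a ≥ 0 together with ‖-x‖ = ‖x‖.
  record Norm (k : ℕ) : Set (c ⊔ ℓ₁ ⊔ ℓ₂) where
    field
      ‖_‖         : (Fin k → Carrier) → Carrier
      ‖‖-cong     : ∀ {x y} → (∀ i → x i ≈ y i) → ‖ x ‖ ≈ ‖ y ‖
      ‖‖-nonneg   : ∀ x → 0# ≤ ‖ x ‖
      ‖‖-definite : ∀ x → ‖ x ‖ ≈ 0# → ∀ i → x i ≈ 0#
      ‖‖-homog    : ∀ a x → 0# ≤ a → ‖ (λ i → a * x i) ‖ ≈ (a * ‖ x ‖)
      ‖‖-neg      : ∀ x → ‖ (λ i → - x i) ‖ ≈ ‖ x ‖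
      ‖‖-triangle : ∀ x y → ‖ (λ i → x i + y i) ‖ ≤ (‖ x ‖ + ‖ y ‖)

  Monotone : ∀ {k} → Norm k → Set (c ⊔ ℓ₂)
  Monotone N = ∀ x y → (∀ i → 0# ≤ x i) → (∀ i → x i ≤ y i) → ‖ x ‖ ≤ ‖ y ‖
    where open Norm N

  r : ∀ {k} → Norm k → Vec ℕ k → Vec ℕ k → Carrier
  r N ȳ y = ‖ (λ i → fromℕ (lookup ȳ i)) ‖
            + ‖ (λ i → fromℕ (lookup y i) + (- fromℕ (lookup ȳ i))) ‖
    where open Norm N

_≤ᵥ_ : ∀ {k} → Vec ℕ k → Vec ℕ k → Set
y ≤ᵥ y' = ∀ i → lookup y i ℕ.≤ lookup y' i

IsParetoOptimal : ∀ {k} → List⁺ (Vec ℕ k) → Vec ℕ k → Set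
IsParetoOptimal Y y =
  (y ∈ toList Y) × (∀ y' → y' ∈ toList Y → ¬ (y' ≡ y) → ¬ (y' ≤ᵥ y))

idealPoint : ∀ {k} → List⁺ (Vec ℕ k) → Vec ℕ k
idealPoint Y = tabulate (λ i → foldr₁ _⊓_ (map⁺ (λ y → lookup y i) Y))

IsFeasibleReference : ∀ {k} → List⁺ (Vec ℕ k) → Vec ℕ k → Set
IsFeasibleReference Y ȳ = ȳ ≤ᵥ idealPoint Y

IsApproxParetoSet : ∀ {c ℓ₁ ℓ₂} (F : OrderedField c ℓ₁ ℓ₂) {k : ℕ} →
  OrderedField.Carrier F → List⁺ (Vec ℕ k) → List (Vec ℕ k) → Set ℓ₂
IsApproxParetoSet F α Y Yα =
  All (_∈ toList Y) Yα ×
  (∀ y → IsParetoOptimal Y y →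
     ∃ λ y' → (y' ∈ Yα) × (∀ i → fromℕ (lookup y' i) ≤ (α * fromℕ (lookup y i))))
  where open OrderedField F

-- Let s minimise r over Y. Among the points of Y dominated by s, one of least
-- coordinate sum is Pareto optimal; call it m, and let y′ ∈ Yα with y′ ≤ α m.
-- Every point of Y lies above ȳ, so 0 ≤ y′ - ȳ ≤ α (m - ȳ) + (α - 1) ȳ, and
-- monotonicity, the triangle inequality and homogeneity (α, α - 1 ≥ 0) give
-- r(y′) ≤ α r(m); monotonicity again gives r(m) ≤ r(s).

module Submission where

open import Defs
open import Data.Nat using (ℕ)
open import Data.Vec using (Vec)
open import Data.List using (List)
open import Data.List.NonEmpty using (List⁺; toList)
open import Data.List.Membership.Propositional using (_∈_)
open import Data.Product using (∃; _×_)

open import Algebra.Bundles using (Ring)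
import Algebra.Properties.CommutativeSemigroup as CommutativeSemigroupProperties
import Algebra.Properties.Ring as RingProperties
open import Data.Fin as Fin using (Fin)
open import Data.Fin.Properties using (all?)
import Data.List as List
open import Data.List.Extrema using (argmin; argmin-all; f[argmin]≤f[⊤]; f[argmin]≤f[xs])
open import Data.List.Membership.Propositional.Properties using (∈-filter⁺; ∈-filter⁻; ∈-map⁺)
open import Data.List.NonEmpty using (_∷_; foldr₁) renaming (map to map⁺)
import Data.List.Relation.Unary.All as All
open import Data.List.Relation.Unary.Any using (here; there)
open import Data.Nat as ℕ using (zero; suc; _⊓_; z≤n; s≤s)
import Data.Nat.Properties as ℕₚ
open import Data.Product using (_,_; proj₁; proj₂)
open import Data.Sum using (inj₁; inj₂)
open import Data.Vec using (_∷_; []; lookup; tabulate; sum)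
open import Data.Vec.Properties using (lookup∘tabulate)
open import Function using (_∘_)
open import Relation.Binary.Bundles using (TotalOrder)
open import Relation.Binary.Definitions using (Decidable)
open import Relation.Binary.PropositionalEquality using (_≡_; refl; cong₂)
import Relation.Binary.Reasoning.PartialOrder as ≤-Reasoning
import Relation.Binary.Reasoning.Setoid as ≈-Reasoning
open import Relation.Binary.Structures using (IsTotalOrder)
open import Relation.Nullary using (¬_)

module _ {b ℓ₁ ℓ₂} (O : TotalOrder b ℓ₁ ℓ₂) {a} {A : Set a} where
  open TotalOrder O using (_≤_)

  ∃-minimiser : (f : A → TotalOrder.Carrier O) (xs : List⁺ A) →
                ∃ λ m → m ∈ toList xs × (∀ {y} → y ∈ toList xs → f m ≤ f y)
  ∃-minimiser f (x ∷ xs) = m , argmin-all O f (here refl) (All.tabulate there) , minimal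
    where
    m : A
    m = argmin O f x xs
    minimal : ∀ {y} → y ∈ x List.∷ xs → f m ≤ f y
    minimal (here refl)  = f[argmin]≤f[⊤] O {f = f} x xs
    minimal (there y∈xs) = All.lookup (f[argmin]≤f[xs] O {f = f} x xs) y∈xs

foldr₁-⊓-≤ : ∀ (ns : List⁺ ℕ) {n} → n ∈ toList ns → foldr₁ _⊓_ ns ℕ.≤ n
foldr₁-⊓-≤ (m ∷ List.[])     (here refl)  = ℕₚ.≤-refl
foldr₁-⊓-≤ (m ∷ l List.∷ ls) (here refl)  = ℕₚ.m⊓n≤m m _
foldr₁-⊓-≤ (m ∷ l List.∷ ls) (there n∈ns) = ℕₚ.≤-trans (ℕₚ.m⊓n≤n m _) (foldr₁-⊓-≤ (l ∷ ls) n∈ns)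

idealPoint-≤ᵥ : ∀ {k} (Y : List⁺ (Vec ℕ k)) {y} → y ∈ toList Y → idealPoint Y ≤ᵥ y
idealPoint-≤ᵥ Y y∈Y i
  rewrite lookup∘tabulate (λ j → foldr₁ _⊓_ (map⁺ (λ v → lookup v j) Y)) i
  = foldr₁-⊓-≤ (map⁺ (λ v → lookup v i) Y) (∈-map⁺ (λ v → lookup v i) y∈Y)

feasibleReference-≤ᵥ : ∀ {k} {Y : List⁺ (Vec ℕ k)} {ȳ y} →
                       IsFeasibleReference Y ȳ → y ∈ toList Y → ȳ ≤ᵥ y
feasibleReference-≤ᵥ {Y = Y} ȳ≤ideal y∈Y i = ℕₚ.≤-trans (ȳ≤ideal i) (idealPoint-≤ᵥ Y y∈Y i)

_≤ᵥ?_ : ∀ {k} → Decidable (_≤ᵥ_ {k})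
y ≤ᵥ? z = all? λ i → lookup y i ℕ.≤? lookup z i

≤ᵥ-trans : ∀ {k} {x y z : Vec ℕ k} → x ≤ᵥ y → y ≤ᵥ z → x ≤ᵥ z
≤ᵥ-trans x≤y y≤z i = ℕₚ.≤-trans (x≤y i) (y≤z i)

sum-mono-≤ᵥ : ∀ {k} {y z : Vec ℕ k} → y ≤ᵥ z → sum y ℕ.≤ sum z
sum-mono-≤ᵥ {y = []}     {[]}     _   = z≤n
sum-mono-≤ᵥ {y = _ ∷ ys} {_ ∷ zs} y≤z =
  ℕₚ.+-mono-≤ (y≤z Fin.zero) (sum-mono-≤ᵥ {y = ys} {zs} (y≤z ∘ Fin.suc))

≤ᵥ-sum-antisym : ∀ {k} {y z : Vec ℕ k} → y ≤ᵥ z → sum z ℕ.≤ sum y → y ≡ z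
≤ᵥ-sum-antisym {y = []}     {[]}     _   _ = refl
≤ᵥ-sum-antisym {y = a ∷ ys} {b ∷ zs} y≤z Σz≤Σy =
  cong₂ _∷_ (ℕₚ.≤-antisym a≤b b≤a) (≤ᵥ-sum-antisym {y = ys} {zs} ys≤zs Σzs≤Σys)
  where
  a≤b : a ℕ.≤ b
  a≤b = y≤z Fin.zero
  ys≤zs : ys ≤ᵥ zs
  ys≤zs = y≤z ∘ Fin.suc
  b≤a : b ℕ.≤ a
  b≤a = ℕₚ.+-cancelʳ-≤ (sum zs) b a
          (ℕₚ.≤-trans Σz≤Σy (ℕₚ.+-monoʳ-≤ a (sum-mono-≤ᵥ {y = ys} {zs} ys≤zs)))
  Σzs≤Σys : sum zs ℕ.≤ sum ys
  Σzs≤Σys = ℕₚ.+-cancelˡ-≤ b (sum zs) (sum ys)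
              (ℕₚ.≤-trans Σz≤Σy (ℕₚ.+-monoˡ-≤ (sum ys) a≤b))

∃-paretoOptimal-≤ᵥ : ∀ {k} (Y : List⁺ (Vec ℕ k)) {s} → s ∈ toList Y →
                     ∃ λ m → IsParetoOptimal Y m × m ≤ᵥ s
∃-paretoOptimal-≤ᵥ Y {s} s∈Y
  with ∃-minimiser ℕₚ.≤-totalOrder sum (s ∷ List.filter (_≤ᵥ? s) (toList Y))
... | m , m∈ , sum-minimal = m , (m∈Y , optimal) , m≤s
  where
  dominated : ∀ {y} → y ∈ s List.∷ List.filter (_≤ᵥ? s) (toList Y) → y ∈ toList Y × y ≤ᵥ s
  dominated (here refl) = s∈Y , λ _ → ℕₚ.≤-refl
  dominated (there y∈)  = ∈-filter⁻ (_≤ᵥ? s) y∈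

  m∈Y : m ∈ toList Y
  m∈Y = proj₁ (dominated m∈)
  m≤s : m ≤ᵥ s
  m≤s = proj₂ (dominated m∈)

  optimal : ∀ y → y ∈ toList Y → ¬ y ≡ m → ¬ y ≤ᵥ m
  optimal y y∈Y y≢m y≤m =
    y≢m (≤ᵥ-sum-antisym {y = y} {m} y≤m (sum-minimal (there (∈-filter⁺ (_≤ᵥ? s) y∈Y y≤s))))
    where
    y≤s : y ≤ᵥ s
    y≤s = ≤ᵥ-trans {x = y} {m} {s} y≤m m≤s

module _ {r₁ r₂} (R : Ring r₁ r₂) where
  open Ring R
  open RingProperties R using (x[y-z]≈xy-xz; [y-z]x≈yx-zx)
  open CommutativeSemigroupProperties +-commutativeSemigroup using (x∙yz≈y∙xz)
  open ≈-Reasoning setoid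

  -x+[x+y]≈y : ∀ x y → - x + (x + y) ≈ y
  -x+[x+y]≈y x y = begin
    - x + (x + y)  ≈⟨ +-assoc (- x) x y ⟨
    (- x + x) + y  ≈⟨ +-congʳ (-‿inverseˡ x) ⟩
    0# + y         ≈⟨ +-identityˡ y ⟩
    y              ∎

  x+[y-x]≈y : ∀ x y → x + (y - x) ≈ y
  x+[y-x]≈y x y = begin
    x + (y - x)    ≈⟨ +-congˡ (+-comm y (- x)) ⟩
    x + (- x + y)  ≈⟨ +-assoc x (- x) y ⟨
    (x - x) + y    ≈⟨ +-congʳ (-‿inverseʳ x) ⟩
    0# + y         ≈⟨ +-identityˡ y ⟩
    y              ∎

  [x-1]y≈xy-y : ∀ x y → (x - 1#) * y ≈ x * y - y
  [x-1]y≈xy-y x y = trans ([y-z]x≈yx-zx y x 1#) (+-congˡ (-‿cong (*-identityˡ y)))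

  xy-z≈x[y-z]+[x-1]z : ∀ x y z → x * y - z ≈ x * (y - z) + (x - 1#) * z
  xy-z≈x[y-z]+[x-1]z x y z = sym (begin
    x * (y - z) + (x - 1#) * z           ≈⟨ +-cong (x[y-z]≈xy-xz x y z) ([x-1]y≈xy-y x z) ⟩
    (x * y - x * z) + (x * z - z)        ≈⟨ +-assoc (x * y) (- (x * z)) (x * z - z) ⟩
    x * y + (- (x * z) + (x * z - z))    ≈⟨ +-congˡ (-x+[x+y]≈y (x * z) (- z)) ⟩
    x * y - z                            ∎)

  z+[xy+[x-1]z]≈x[z+y] : ∀ x y z → z + (x * y + (x - 1#) * z) ≈ x * (z + y)
  z+[xy+[x-1]z]≈x[z+y] x y z = begin
    z + (x * y + (x - 1#) * z)     ≈⟨ +-congˡ (+-congˡ ([x-1]y≈xy-y x z)) ⟩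
    z + (x * y + (x * z - z))      ≈⟨ x∙yz≈y∙xz z (x * y) (x * z - z) ⟩
    x * y + (z + (x * z - z))      ≈⟨ +-congˡ (x+[y-x]≈y z (x * z)) ⟩
    x * y + x * z                  ≈⟨ +-comm (x * y) (x * z) ⟩
    x * z + x * y                  ≈⟨ distribˡ x z y ⟨
    x * (z + y)                    ∎

module _ {c ℓ₁ ℓ₂} (F : OrderedField c ℓ₁ ℓ₂) where
  open OrderedField F
  open IsTotalOrder isTotalOrder
    using (total; ≤-respˡ-≈; ≤-respʳ-≈) renaming (refl to ≤-refl; trans to ≤-trans)
  open RingProperties ring using (-1*x≈-x; -‿involutive; x[y-z]≈xy-xz)

  totalOrder : TotalOrder c ℓ₁ ℓ₂
  totalOrder = record { isTotalOrder = isTotalOrder }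

  +-monoʳ-≤ : ∀ z {x y} → x ≤ y → (z + x) ≤ (z + y)
  +-monoʳ-≤ z {x} {y} x≤y = ≤-respˡ-≈ (+-comm x z) (≤-respʳ-≈ (+-comm y z) (+-mono-≤ z x≤y))

  x≤y⇒0≤y-x : ∀ {x y} → x ≤ y → 0# ≤ (y - x)
  x≤y⇒0≤y-x {x} x≤y = ≤-respˡ-≈ (-‿inverseʳ x) (+-mono-≤ (- x) x≤y)

  0≤y-x⇒x≤y : ∀ {x y} → 0# ≤ (y - x) → x ≤ y
  0≤y-x⇒x≤y {x} {y} 0≤y-x =
    ≤-respˡ-≈ (+-identityʳ x) (≤-respʳ-≈ (x+[y-x]≈y ring x y) (+-monoʳ-≤ x 0≤y-x))

  *-monoˡ-≤-nonNeg : ∀ {x y z} → 0# ≤ z → x ≤ y → (z * x) ≤ (z * y)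
  *-monoˡ-≤-nonNeg {x} {y} {z} 0≤z x≤y =
    0≤y-x⇒x≤y (≤-respʳ-≈ (x[y-z]≈xy-xz z y x) (*-nonneg 0≤z (x≤y⇒0≤y-x x≤y)))

  -- If 1 ≤ 0 then 0 ≤ -1, and 1 = (-1)(-1) is a product of nonnegatives.
  0≤1 : 0# ≤ 1#
  0≤1 with total 0# 1#
  ... | inj₁ 0≤1 = 0≤1
  ... | inj₂ 1≤0 = ≤-respʳ-≈ (trans (-1*x≈-x (- 1#)) (-‿involutive 1#)) (*-nonneg 0≤-1 0≤-1)
    where
    0≤-1 : 0# ≤ (- 1#)
    0≤-1 = ≤-respʳ-≈ (+-identityˡ (- 1#)) (x≤y⇒0≤y-x 1≤0)

  1≤x⇒0≤x : ∀ {x} → 1# ≤ x → 0# ≤ x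
  1≤x⇒0≤x = ≤-trans 0≤1

  x≤1+x : ∀ x → x ≤ (1# + x)
  x≤1+x x = ≤-respˡ-≈ (+-identityˡ x) (+-mono-≤ x 0≤1)

  fromℕ-mono-≤ : ∀ {m n} → m ℕ.≤ n → fromℕ m ≤ fromℕ n
  fromℕ-mono-≤ {n = zero}  z≤n       = ≤-refl
  fromℕ-mono-≤ {n = suc n} z≤n       = ≤-trans (fromℕ-mono-≤ {n = n} z≤n) (x≤1+x (fromℕ n))
  fromℕ-mono-≤             (s≤s m≤n) = +-monoʳ-≤ 1# (fromℕ-mono-≤ m≤n)

  fromℕᵛ : ∀ {k} → Vec ℕ k → Fin k → Carrier
  fromℕᵛ v i = fromℕ (lookup v i)

  module _ {k} (N : Norm F k) (monotone : Monotone F N) where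
    open Norm N
    open ≤-Reasoning (TotalOrder.poset totalOrder)

    -- r F N ȳ y is definitionally ρ (fromℕᵛ ȳ) (fromℕᵛ y).
    ρ : (Fin k → Carrier) → (Fin k → Carrier) → Carrier
    ρ b x = ‖ b ‖ + ‖ (λ i → x i - b i) ‖

    ρ-mono : ∀ {b x z} → (∀ i → b i ≤ x i) → (∀ i → x i ≤ z i) → ρ b x ≤ ρ b z
    ρ-mono {b} b≤x x≤z =
      +-monoʳ-≤ ‖ b ‖ (monotone _ _ (x≤y⇒0≤y-x ∘ b≤x) (λ i → +-mono-≤ (- b i) (x≤z i)))

    ρ-scale : ∀ {α b x z} → 1# ≤ α → (∀ i → b i ≤ x i) → (∀ i → x i ≤ (α * z i)) →
              ρ b x ≤ (α * ρ b z)
    ρ-scale {α} {b} {x} {z} 1≤α b≤x x≤αz = begin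
      ‖ b ‖ + ‖ (λ i → x i - b i) ‖
        ≤⟨ +-monoʳ-≤ ‖ b ‖ (monotone _ _ (x≤y⇒0≤y-x ∘ b≤x) x-b≤α[z-b]+[α-1]b) ⟩
      ‖ b ‖ + ‖ (λ i → α * (z i - b i) + (α - 1#) * b i) ‖
        ≤⟨ +-monoʳ-≤ ‖ b ‖ (‖‖-triangle _ _) ⟩
      ‖ b ‖ + (‖ (λ i → α * (z i - b i)) ‖ + ‖ (λ i → (α - 1#) * b i) ‖)
        ≈⟨ +-congˡ (+-cong (‖‖-homog α _ (1≤x⇒0≤x 1≤α)) (‖‖-homog (α - 1#) b 0≤α-1)) ⟩
      ‖ b ‖ + (α * ‖ (λ i → z i - b i) ‖ + (α - 1#) * ‖ b ‖)
        ≈⟨ z+[xy+[x-1]z]≈x[z+y] ring α _ ‖ b ‖ ⟩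
      α * (‖ b ‖ + ‖ (λ i → z i - b i) ‖) ∎
      where
      0≤α-1 : 0# ≤ (α - 1#)
      0≤α-1 = x≤y⇒0≤y-x 1≤α
      x-b≤α[z-b]+[α-1]b : ∀ i → (x i - b i) ≤ (α * (z i - b i) + (α - 1#) * b i)
      x-b≤α[z-b]+[α-1]b i =
        ≤-respʳ-≈ (xy-z≈x[y-z]+[x-1]z ring α (z i) (b i)) (+-mono-≤ (- b i) (x≤αz i))

lemma3 : ∀ {c ℓ₁ ℓ₂} (F : OrderedField c ℓ₁ ℓ₂) (k : ℕ)
           (Y : List⁺ (Vec ℕ k)) (ȳ : Vec ℕ k) → IsFeasibleReference Y ȳ →
           (α : OrderedField.Carrier F) → OrderedField._<_ F (OrderedField.1# F) α →
           (Yα : List (Vec ℕ k)) → IsApproxParetoSet F α Y Yα →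
           (N : Norm F k) → Monotone F N →
           ∃ λ y' → (y' ∈ Yα) ×
             (∀ y → y ∈ toList Y →
                OrderedField._≤_ F (r F N ȳ y') (OrderedField._*_ F α (r F N ȳ y)))
lemma3 F k Y ȳ feasible α (1≤α , _) Yα (Yα⊆Y , approximates) N monotone
  with ∃-minimiser (totalOrder F) (r F N ȳ) Y
... | s , s∈Y , s-minimal with ∃-paretoOptimal-≤ᵥ Y s∈Y
... | m , m-optimal@(m∈Y , _) , m≤s with approximates m m-optimal
... | y′ , y′∈Yα , y′≤αm = y′ , y′∈Yα , bound
  where
  open OrderedField F using (_≤_; _*_)
  open ≤-Reasoning (TotalOrder.poset (totalOrder F))

  ȳ≤ : ∀ {y} → y ∈ toList Y → ∀ i → fromℕᵛ F ȳ i ≤ fromℕᵛ F y i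
  ȳ≤ y∈Y = fromℕ-mono-≤ F ∘ feasibleReference-≤ᵥ {ȳ = ȳ} feasible y∈Y

  bound : ∀ y → y ∈ toList Y → r F N ȳ y′ ≤ (α * r F N ȳ y)
  bound y y∈Y = begin
    r F N ȳ y′      ≤⟨ ρ-scale F N monotone 1≤α (ȳ≤ (All.lookup Yα⊆Y y′∈Yα)) y′≤αm ⟩
    α * r F N ȳ m   ≤⟨ *-monoˡ-≤-nonNeg F (1≤x⇒0≤x F 1≤α)
                         (ρ-mono F N monotone (ȳ≤ m∈Y) (fromℕ-mono-≤ F ∘ m≤s)) ⟩
    α * r F N ȳ s   ≤⟨ *-monoˡ-≤-nonNeg F (1≤x⇒0≤x F 1≤α) (s-minimal y∈Y) ⟩
    α * r F N ȳ y   ∎
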